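{- Let $\mathbf{d}=(d_1,\dots,d_n)$ be a graphical sequence with $\sum_{i=1}^n d_i=4(n-1)-4$, $d_1\le 4$ and $d_n=3$. Then $\mathbf{d}$ admits a realization which is a $C_4$-pivotable graph.
   Context: A degree sequence is non-increasing, $d_1\ge\dots\ge d_n\ge 0$; it is graphical if some simple graph on $v_1,\dots,v_n$ has $\deg(v_i)=d_i$ (a realization). A simple graph $G$ on $n$ vertices with exactly $2n-4$ edges is $C_4$-pivotable if $G$ contains an induced cycle $C$ of length 4 and two spanning trees whose edge sets have exactly two common edges, both of which are edges of $C$. -}

module Defs where

open import Data.Nat using (ℕ; zero; suc; _+_; _*_; _≤_; _<ᵇ_)
open import Data.Bool using (Bool; true; false; if_then_else_; _∧_)
open import Data.Fin using (Fin; zero; suc; toℕ; inject₁; fromℕ)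
open import Data.List using (List; map; allFin)
open import Data.Nat.ListAction using (sum)
open import Data.Product using (Σ; _×_; ∃; ∃-syntax; _,_)
open import Data.Sum using (_⊎_)
open import Relation.Binary.PropositionalEquality using (_≡_; _≢_)
open import Relation.Nullary using (¬_)
open import Function.Definitions using (Injective)

record Graph (n : ℕ) : Set where
  field
    adj   : Fin n → Fin n → Bool
    sym   : ∀ u v → adj u v ≡ adj v u
    irrefl : ∀ v → adj v v ≡ false
open Graph public

Edge : ∀ {n} → Graph n → Fin n → Fin n → Set
Edge G u v = adj G u v ≡ true

countFin : ∀ {n} → (Fin n → Bool) → ℕ
countFin {n} p = sum (map (λ j → if p j then 1 else 0) (allFin n))

degree : ∀ {n} → Graph n → Fin n → ℕ
degree G v = countFin (adj G v)

edgeCount : ∀ {n} → Graph n → ℕ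
edgeCount {n} G = sum (map (λ u → countFin (λ v → adj G u v ∧ (toℕ u <ᵇ toℕ v))) (allFin n))

_⊆G_ : ∀ {n} → Graph n → Graph n → Set
H ⊆G G = ∀ u v → Edge H u v → Edge G u v

data Walk {n} (G : Graph n) : Fin n → Fin n → Set where
  here : ∀ {v} → Walk G v v
  step : ∀ {u w v} → Edge G u w → Walk G w v → Walk G u v

Connected : ∀ {n} → Graph n → Set
Connected G = ∀ u v → Walk G u v

-- a cycle of length k+3 in G: injective cyclic sequence of vertices,
-- consecutive ones adjacent
record Cycle {n} (G : Graph n) : Set where
  field
    k    : ℕ
    vtx  : Fin (suc (suc (suc k))) → Fin n
    inj  : Injective _≡_ _≡_ vtx
    cons : ∀ (i : Fin (suc (suc k))) → Edge G (vtx (inject₁ i)) (vtx (suc i))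
    wrap : Edge G (vtx (fromℕ (suc (suc k)))) (vtx zero)

Acyclic : ∀ {n} → Graph n → Set
Acyclic G = ¬ Cycle G

SpanningTree : ∀ {n} → Graph n → Graph n → Set
SpanningTree G T = (T ⊆G G) × Connected T × Acyclic T

InducedC4 : ∀ {n} → Graph n → Fin n → Fin n → Fin n → Fin n → Set
InducedC4 G a b c e =
  (a ≢ b) × (a ≢ c) × (a ≢ e) × (b ≢ c) × (b ≢ e) × (c ≢ e) ×
  Edge G a b × Edge G b c × Edge G c e × Edge G e a ×
  adj G a c ≡ false × adj G b e ≡ false

C4Edge : ∀ {n} → Fin n → Fin n → Fin n → Fin n → Fin n → Fin n → Set
C4Edge a b c e u v =
  ((u ≡ a × v ≡ b) ⊎ (u ≡ b × v ≡ a)) ⊎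
  ((u ≡ b × v ≡ c) ⊎ (u ≡ c × v ≡ b)) ⊎
  ((u ≡ c × v ≡ e) ⊎ (u ≡ e × v ≡ c)) ⊎
  ((u ≡ e × v ≡ a) ⊎ (u ≡ a × v ≡ e))

commonGraph : ∀ {n} → Graph n → Graph n → Graph n
commonGraph T₁ T₂ = record
  { adj = λ u v → adj T₁ u v ∧ adj T₂ u v
  ; sym = λ u v → cong2 (sym T₁ u v) (sym T₂ u v)
  ; irrefl = λ v → irr (adj T₁ v v) (adj T₂ v v) (irrefl T₁ v)
  }
  where
  open import Relation.Binary.PropositionalEquality using (cong₂; refl)
  cong2 = cong₂ _∧_
  irr : ∀ x y → x ≡ false → (x ∧ y) ≡ false
  irr false y refl = refl

C4Pivotable : ∀ {n} → Graph n → Set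
C4Pivotable {n} G =
  (edgeCount G + 4 ≡ 2 * n) ×
  Σ (Fin n) λ a → Σ (Fin n) λ b → Σ (Fin n) λ c → Σ (Fin n) λ e →
    InducedC4 G a b c e ×
    Σ (Graph n) λ T₁ → Σ (Graph n) λ T₂ →
      SpanningTree G T₁ × SpanningTree G T₂ ×
      edgeCount (commonGraph T₁ T₂) ≡ 2 ×
      (∀ u v → Edge (commonGraph T₁ T₂) u v → C4Edge a b c e u v)

NonIncreasing : ∀ {n} → (Fin n → ℕ) → Set
NonIncreasing {n} d = ∀ (i j : Fin n) → toℕ i ≤ toℕ j → d j ≤ d i

Realizes : ∀ {n} → Graph n → (Fin n → ℕ) → Set
Realizes G d = ∀ i → degree G i ≡ d i

Graphical : ∀ {n} → (Fin n → ℕ) → Set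
Graphical {n} d = NonIncreasing d × Σ (Graph n) λ G → Realizes G d

seqSum : ∀ {n} → (Fin n → ℕ) → ℕ
seqSum {n} d = sum (map d (allFin n))

{-# OPTIONS --safe #-}
module Submission where

-- All terms are 3 or 4, so the degree sum forces d = 4^L 3^8 with n = 8 + L.  Start from an
-- 8-vertex graph that is the union of two spanning trees T₁ and T₂, is 3-regular, and whose
-- only common edges are 5–4 and 4–6 of the induced 4-cycle 5–4–6–7.  Each step puts a new
-- vertex in front (so that the degree-4 vertices come first) and uses it to subdivide an edge
-- of T₁ outside T₂ and an edge of T₂ outside T₁ with disjoint ends.  Both trees remain
-- spanning trees, the new vertex gets degree 4 in the union, old degrees and common edges are
-- unchanged, and the edge count 2n − 4 follows from the handshake lemma.  Acyclicity is
-- carried along by a ranking, in which adjacent ranks differ and no vertex has two lower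
-- neighbours: the highest vertex of a cycle would have two.

open import Defs
open import Data.Bool using (Bool; true; false; _∧_; _∨_; not; if_then_else_)
open import Data.Bool.ListAction using (any)
open import Data.Bool.Properties
  using (∧-identityʳ; ∧-zeroʳ; ∧-comm; ∨-identityʳ; ∨-zeroʳ; ∨-comm; T-≡)
  renaming (_≟_ to _≟ᵇ_)
open import Data.Empty using (⊥; ⊥-elim)
open import Data.Fin using (Fin; zero; suc; toℕ; fromℕ; inject₁)
open import Data.Fin.Patterns using (0F; 1F; 2F; 3F; 4F; 5F; 6F; 7F)
open import Data.Fin.Properties
  using (all?; _≟_; toℕ-injective; toℕ-inject₁; toℕ-fromℕ; toℕ≤pred[n])
  renaming (suc-injective to Fin-suc-injective)
open import Data.Fin.Relation.Unary.Top using (view; ‵fromℕ; ‵inject₁)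
open import Data.List using (List; []; _∷_; map; allFin; tabulate)
open import Data.List.Extrema.Nat using (argmax; f[xs]≤f[argmax])
open import Data.List.Membership.Propositional.Properties using (∈-allFin)
open import Data.List.Properties using (map-tabulate)
import Data.List.Relation.Unary.All as All
open import Data.Nat using (ℕ; zero; suc; _+_; _*_; _≤_; _<_; _<ᵇ_; z≤n; s≤s)
open import Data.Nat.Induction using (<-wellFounded)
open import Data.Nat.ListAction using (sum)
open import Data.Nat.Properties
  using ( _<?_; +-0-commutativeMonoid; +-suc; +-identityʳ; <-cmp; <ᵇ⇒<; <⇒<ᵇ; <-irrefl; <-asym
        ; <⇒≢; <⇒≱; ≰⇒>; ≮⇒≥; ≤∧≢⇒<; ≤-antisym; ≤-trans; ≤-reflexive; ≤-pred; n≤0⇒n≡0; m≤n+m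
        ; m≢1+n+m; m≤n⇒m<n∨m≡n; m≤n⇒∃[o]m+o≡n; +-mono-<; +-mono-≤; +-monoˡ-≤; +-monoʳ-≤
        ; suc-injective; +-cancelˡ-≡; +-cancelʳ-≡; +-cancelˡ-<; +-cancelʳ-<; +-cancelʳ-≤; module ≤-Reasoning )
  renaming (_≟_ to _≟ℕ_)
open import Data.Nat.Tactic.RingSolver using (solve-∀)
open import Data.Product as Product using (Σ; _×_; _,_; proj₁; proj₂)
open import Data.Sum as Sum using (_⊎_; inj₁; inj₂)
open import Data.Vec using ([]; _∷_; lookup)
open import Function using (_∘_; Equivalence)
open import Induction.WellFounded using (Acc; acc)
open import Relation.Binary using (tri<; tri≈; tri>)
open import Relation.Binary.PropositionalEquality as ≡
  using (_≡_; _≢_; refl; cong; cong₂; module ≡-Reasoning)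
open import Relation.Nullary using (¬_; contradiction)
open import Relation.Nullary.Decidable
  using (Dec; does; yes; no; dec-true; dec-false; from-yes; ¬?; _→-dec_; _×-dec_; _⊎-dec_)
open import Algebra.Properties.CommutativeMonoid.Sum +-0-commutativeMonoid
  using (sum-cong-≗; ∑-distrib-+; ∑-comm) renaming (sum to ∑)

double-injective : ∀ {m n} → m + m ≡ n + n → m ≡ n
double-injective e = ≤-antisym (≮⇒≥ (λ n<m → <-irrefl (≡.sym e) (+-mono-< n<m n<m)))
                               (≮⇒≥ (λ m<n → <-irrefl e (+-mono-< m<n m<n)))

double-cancel-< : ∀ {m n} → m + m < n + n → m < n
double-cancel-< m+m<n+n = ≰⇒> (λ n≤m → <⇒≱ m+m<n+n (+-mono-≤ n≤m n≤m))

<ᵇ-true : ∀ {m n} → m < n → (m <ᵇ n) ≡ true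
<ᵇ-true = Equivalence.to T-≡ ∘ <⇒<ᵇ

<ᵇ-false : ∀ {m n} → ¬ m < n → (m <ᵇ n) ≡ false
<ᵇ-false {m} {n} m≮n with m <ᵇ n in m<ᵇn
... | false = refl
... | true  = contradiction (<ᵇ⇒< m n (Equivalence.from T-≡ m<ᵇn)) m≮n

-- Counting over Fin

-- Written with if_then_else_ so that bit ∘ p is literally the summand of countFin p.
bit : Bool → ℕ
bit b = if b then 1 else 0

count : ∀ {n} → (Fin n → Bool) → ℕ
count p = ∑ (bit ∘ p)

sum-map-allFin : ∀ {n} (f : Fin n → ℕ) → sum (map f (allFin n)) ≡ ∑ f
sum-map-allFin f = ≡.trans (cong sum (map-tabulate (λ i → i) f)) (sum-tabulate f)
  where
  sum-tabulate : ∀ {n} (f : Fin n → ℕ) → sum (tabulate f) ≡ ∑ f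
  sum-tabulate {zero}  f = refl
  sum-tabulate {suc n} f = cong (f zero +_) (sum-tabulate (f ∘ suc))

degree≡count : ∀ {n} (G : Graph n) v → degree G v ≡ count (adj G v)
degree≡count G v = sum-map-allFin (bit ∘ adj G v)

edgeCount≡∑ : ∀ {n} (G : Graph n) → edgeCount G ≡ ∑ (λ u → count (λ v → adj G u v ∧ (toℕ u <ᵇ toℕ v)))
edgeCount≡∑ G =
  ≡.trans (sum-map-allFin (λ u → countFin (λ v → adj G u v ∧ (toℕ u <ᵇ toℕ v))))
          (sum-cong-≗ (λ u → sum-map-allFin (λ v → bit (adj G u v ∧ (toℕ u <ᵇ toℕ v)))))

count-cong : ∀ {n} {p q : Fin n → Bool} → (∀ j → p j ≡ q j) → count p ≡ count q
count-cong p≗q = sum-cong-≗ (cong bit ∘ p≗q)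

count-none : ∀ {n} (p : Fin n → Bool) → (∀ j → p j ≡ false) → count p ≡ 0
count-none {zero}  p p≗false = refl
count-none {suc n} p p≗false rewrite p≗false zero = count-none (p ∘ suc) (p≗false ∘ suc)

count-singleton : ∀ {n} (x : Fin n) → count (λ j → does (j ≟ x)) ≡ 1
count-singleton {suc n} zero    = cong suc (count-none {n} (λ j → does (suc j ≟ zero)) (λ _ → refl))
count-singleton {suc n} (suc x) = count-singleton {n} x

count-∨+count-∧ : ∀ {n} (p q : Fin n → Bool) →
  count (λ j → p j ∨ q j) + count (λ j → p j ∧ q j) ≡ count p + count q
count-∨+count-∧ p q = begin
  count (λ j → p j ∨ q j) + count (λ j → p j ∧ q j)
    ≡⟨ ∑-distrib-+ (λ j → bit (p j ∨ q j)) (λ j → bit (p j ∧ q j)) ⟨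
  ∑ (λ j → bit (p j ∨ q j) + bit (p j ∧ q j))
    ≡⟨ sum-cong-≗ (λ j → bit-∨+bit-∧ (p j) (q j)) ⟩
  ∑ (λ j → bit (p j) + bit (q j))
    ≡⟨ ∑-distrib-+ (bit ∘ p) (bit ∘ q) ⟩
  count p + count q
    ∎
  where
  open ≡-Reasoning
  bit-∨+bit-∧ : ∀ x y → bit (x ∨ y) + bit (x ∧ y) ≡ bit x + bit y
  bit-∨+bit-∧ true  true  = refl
  bit-∨+bit-∧ true  false = refl
  bit-∨+bit-∧ false true  = refl
  bit-∨+bit-∧ false false = refl

count-remove : ∀ {n} (p : Fin n → Bool) {x} → p x ≡ true →
  count p ≡ suc (count (λ j → p j ∧ not (does (j ≟ x))))
count-remove p {zero}  px rewrite px = cong suc (count-cong (λ j → ≡.sym (∧-identityʳ (p (suc j)))))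
count-remove p {suc x} px rewrite ∧-identityʳ (p zero) =
  ≡.trans (cong (bit (p zero) +_) (count-remove (p ∘ suc) px)) (+-suc _ _)

edge-orientations : ∀ {n} (G : Graph n) u v →
  bit (adj G u v) ≡ bit (adj G u v ∧ (toℕ u <ᵇ toℕ v)) + bit (adj G v u ∧ (toℕ v <ᵇ toℕ u))
edge-orientations G u v with <-cmp (toℕ u) (toℕ v)
... | tri< u<v _ v≮u
  rewrite <ᵇ-true u<v | <ᵇ-false v≮u | ∧-identityʳ (adj G u v) | ∧-zeroʳ (adj G v u) = ≡.sym (+-identityʳ _)
... | tri≈ _ u≡v _ with toℕ-injective u≡v
...   | refl rewrite irrefl G u = refl
edge-orientations G u v | tri> u≮v _ v<u
  rewrite <ᵇ-false u≮v | <ᵇ-true v<u | ∧-zeroʳ (adj G u v) | ∧-identityʳ (adj G v u) =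
  cong bit (sym G u v)

handshake : ∀ {n} (G : Graph n) → ∑ (degree G) ≡ edgeCount G + edgeCount G
handshake {n} G = begin
  ∑ (degree G)
    ≡⟨ sum-cong-≗ (degree≡count G) ⟩
  ∑ (λ u → ∑ (λ v → bit (adj G u v)))
    ≡⟨ sum-cong-≗ (λ u → sum-cong-≗ (edge-orientations G u)) ⟩
  ∑ (λ u → ∑ (λ v → forward u v + forward v u))
    ≡⟨ sum-cong-≗ (λ u → ∑-distrib-+ (forward u) _) ⟩
  ∑ (λ u → ∑ (forward u) + ∑ (λ v → forward v u))
    ≡⟨ ∑-distrib-+ (∑ ∘ forward) (λ u → ∑ (λ v → forward v u)) ⟩
  ∑ (λ u → ∑ (forward u)) + ∑ (λ u → ∑ (λ v → forward v u))
    ≡⟨ cong (∑ (∑ ∘ forward) +_) (∑-comm (λ u v → forward v u)) ⟩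
  ∑ (λ u → ∑ (forward u)) + ∑ (λ v → ∑ (forward v))
    ≡⟨ cong₂ _+_ (edgeCount≡∑ G) (edgeCount≡∑ G) ⟨
  edgeCount G + edgeCount G
    ∎
  where
  open ≡-Reasoning
  forward : Fin n → Fin n → ℕ
  forward u v = bit (adj G u v ∧ (toℕ u <ᵇ toℕ v))

-- Graph operations

Edge-sym : ∀ {n} (G : Graph n) {u v} → Edge G u v → Edge G v u
Edge-sym G {u} {v} e = ≡.trans (sym G v u) e

Edge⇒≢ : ∀ {n} (G : Graph n) {u v} → Edge G u v → u ≢ v
Edge⇒≢ G {u} e refl with ≡.trans (≡.sym e) (irrefl G u)
... | ()

_∪G_ : ∀ {n} → Graph n → Graph n → Graph n
G ∪G H = record
  { adj    = λ u v → adj G u v ∨ adj H u v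
  ; sym    = λ u v → cong₂ _∨_ (sym G u v) (sym H u v)
  ; irrefl = λ v → cong₂ _∨_ (irrefl G v) (irrefl H v)
  }

∪-left : ∀ {n} (G H : Graph n) {u v} → Edge G u v → Edge (G ∪G H) u v
∪-left G H e = cong (_∨ _) e

∪-right : ∀ {n} (G H : Graph n) {u v} → Edge H u v → Edge (G ∪G H) u v
∪-right G H {u} {v} e = ≡.trans (cong (adj G u v ∨_) e) (∨-zeroʳ _)

common⇒∪ : ∀ {n} (G H : Graph n) {u v} → Edge (commonGraph G H) u v → Edge (G ∪G H) u v
common⇒∪ G H {u} {v} e with adj G u v
... | true = refl

C4Edge-map : ∀ {m n} (f : Fin m → Fin n) {a b c e u v} →
  C4Edge a b c e u v → C4Edge (f a) (f b) (f c) (f e) (f u) (f v)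
C4Edge-map f = Sum.map pair (Sum.map pair (Sum.map pair pair))
  where
  both : ∀ {x y z w} → x ≡ y × z ≡ w → f x ≡ f y × f z ≡ f w
  both = Product.map (cong f) (cong f)
  pair : ∀ {x y z w} → (x ≡ y × z ≡ w) ⊎ (x ≡ w × z ≡ y) → (f x ≡ f y × f z ≡ f w) ⊎ (f x ≡ f w × f z ≡ f y)
  pair = Sum.map both both

degree-∪ : ∀ {n} (G H : Graph n) v →
  degree (G ∪G H) v + degree (commonGraph G H) v ≡ degree G v + degree H v
degree-∪ G H v = begin
  degree (G ∪G H) v + degree (commonGraph G H) v
    ≡⟨ cong₂ _+_ (degree≡count (G ∪G H) v) (degree≡count (commonGraph G H) v) ⟩
  count (adj (G ∪G H) v) + count (adj (commonGraph G H) v)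
    ≡⟨ count-∨+count-∧ (adj G v) (adj H v) ⟩
  count (adj G v) + count (adj H v)
    ≡⟨ cong₂ _+_ (degree≡count G v) (degree≡count H v) ⟨
  degree G v + degree H v
    ∎
  where open ≡-Reasoning

endpoint-view : ∀ {n} (a b v : Fin n) → v ≡ a ⊎ v ≡ b ⊎ (v ≢ a × v ≢ b)
endpoint-view a b v with v ≟ a | v ≟ b
... | yes v≡a | _       = inj₁ v≡a
... | no _    | yes v≡b = inj₂ (inj₁ v≡b)
... | no v≢a  | no v≢b  = inj₂ (inj₂ (v≢a , v≢b))

oneOf : ∀ {n} → Fin n → Fin n → Fin n → Bool
oneOf a b v = does (v ≟ a) ∨ does (v ≟ b)

oneOf-true : ∀ {n} (a b v : Fin n) → oneOf a b v ≡ true → v ≡ a ⊎ v ≡ b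
oneOf-true a b v v∈ab with v ≟ a | v ≟ b
... | yes v≡a | _       = inj₁ v≡a
... | no _    | yes v≡b = inj₂ v≡b

oneOf-left : ∀ {n} (a b : Fin n) → oneOf a b a ≡ true
oneOf-left a b rewrite dec-true (a ≟ a) refl = refl

oneOf-right : ∀ {n} (a b : Fin n) → oneOf a b b ≡ true
oneOf-right a b rewrite dec-true (b ≟ b) refl = ∨-zeroʳ _

count-oneOf : ∀ {n} {a b : Fin n} → a ≢ b → count (oneOf a b) ≡ 2
count-oneOf {a = a} {b} a≢b = begin
  count (oneOf a b)
    ≡⟨ +-identityʳ _ ⟨
  count (oneOf a b) + 0
    ≡⟨ cong (count (oneOf a b) +_) (count-none both both-false) ⟨
  count (oneOf a b) + count both
    ≡⟨ count-∨+count-∧ (λ j → does (j ≟ a)) (λ j → does (j ≟ b)) ⟩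
  count (λ j → does (j ≟ a)) + count (λ j → does (j ≟ b))
    ≡⟨ cong₂ _+_ (count-singleton a) (count-singleton b) ⟩
  2
    ∎
  where
  open ≡-Reasoning
  both : Fin _ → Bool
  both j = does (j ≟ a) ∧ does (j ≟ b)
  both-false : ∀ j → both j ≡ false
  both-false j with j ≟ a
  ... | yes refl = dec-false (j ≟ b) a≢b
  ... | no _     = refl

samePair : ∀ {n} → Fin n → Fin n → Fin n → Fin n → Bool
samePair a b u v = (does (u ≟ a) ∧ does (v ≟ b)) ∨ (does (u ≟ b) ∧ does (v ≟ a))

samePair-sym : ∀ {n} (a b u v : Fin n) → samePair a b u v ≡ samePair a b v u
samePair-sym a b u v = ≡.trans (∨-comm (does (u ≟ a) ∧ does (v ≟ b)) _)
                               (cong₂ _∨_ (∧-comm (does (u ≟ b)) _) (∧-comm (does (u ≟ a)) _))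

samePair-true : ∀ {n} (a b u v : Fin n) → samePair a b u v ≡ true → (u ≡ a × v ≡ b) ⊎ (u ≡ b × v ≡ a)
samePair-true a b u v same with u ≟ a | v ≟ b | u ≟ b | v ≟ a
... | yes u≡a | yes v≡b | _       | _       = inj₁ (u≡a , v≡b)
... | yes _   | no _    | yes u≡b | yes v≡a = inj₂ (u≡b , v≡a)
... | no _    | _       | yes u≡b | yes v≡a = inj₂ (u≡b , v≡a)

samePair-ab : ∀ {n} (a b : Fin n) → samePair a b a b ≡ true
samePair-ab a b rewrite dec-true (a ≟ a) refl | dec-true (b ≟ b) refl = refl

samePair-ba : ∀ {n} (a b : Fin n) → samePair a b b a ≡ true
samePair-ba a b rewrite dec-true (a ≟ a) refl | dec-true (b ≟ b) refl = ∨-zeroʳ _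

samePair-adj : ∀ {n} (G : Graph n) {a b x} → adj G a b ≡ x →
  ∀ u v → samePair a b u v ≡ true → adj G u v ≡ x
samePair-adj G {a} {b} ab≡x u v same with samePair-true a b u v same
... | inj₁ (refl , refl) = ab≡x
... | inj₂ (refl , refl) = ≡.trans (sym G b a) ab≡x

removeEdge : ∀ {n} → Graph n → Fin n → Fin n → Graph n
removeEdge T a b = record
  { adj    = λ u v → adj T u v ∧ not (samePair a b u v)
  ; sym    = λ u v → cong₂ (λ x y → x ∧ not y) (sym T u v) (samePair-sym a b u v)
  ; irrefl = λ v → cong (_∧ not (samePair a b v v)) (irrefl T v)
  }

addVertex : ∀ {n} → Graph n → (Fin n → Bool) → Graph (suc n)
addVertex {n} G N = record { adj = A ; sym = A-sym ; irrefl = A-irrefl }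
  where
  A : Fin (suc n) → Fin (suc n) → Bool
  A zero    zero    = false
  A zero    (suc v) = N v
  A (suc u) zero    = N u
  A (suc u) (suc v) = adj G u v
  A-sym : ∀ u v → A u v ≡ A v u
  A-sym zero    zero    = refl
  A-sym zero    (suc v) = refl
  A-sym (suc u) zero    = refl
  A-sym (suc u) (suc v) = sym G u v
  A-irrefl : ∀ v → A v v ≡ false
  A-irrefl zero    = refl
  A-irrefl (suc v) = irrefl G v

subdivide : ∀ {n} → Graph n → Fin n → Fin n → Graph (suc n)
subdivide T a b = addVertex (removeEdge T a b) (oneOf a b)

degree-addVertex-zero : ∀ {n} (G : Graph n) N → degree (addVertex G N) zero ≡ count N
degree-addVertex-zero G N = degree≡count (addVertex G N) zero

degree-addVertex-suc : ∀ {n} (G : Graph n) N v → degree (addVertex G N) (suc v) ≡ bit (N v) + degree G v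
degree-addVertex-suc G N v =
  ≡.trans (degree≡count (addVertex G N) (suc v)) (cong (bit (N v) +_) (≡.sym (degree≡count G v)))

module _ {n} (G : Graph (suc n)) (H : Graph n) (isolated : ∀ v → adj G zero v ≡ false)
  (restricts : ∀ u v → adj G (suc u) (suc v) ≡ adj H u v) where

  degree-isolated-zero : degree G zero ≡ 0
  degree-isolated-zero = ≡.trans (degree≡count G zero) (count-none (adj G zero) isolated)

  degree-isolated-suc : ∀ v → degree G (suc v) ≡ degree H v
  degree-isolated-suc v = begin
    degree G (suc v)                                       ≡⟨ degree≡count G (suc v) ⟩
    bit (adj G (suc v) zero) + count (adj G (suc v) ∘ suc)
      ≡⟨ cong₂ _+_ (cong bit (≡.trans (sym G (suc v) zero) (isolated (suc v))))
                   (count-cong (restricts v)) ⟩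
    count (adj H v)                                        ≡⟨ degree≡count H v ⟨
    degree H v                                             ∎
    where open ≡-Reasoning

  edgeCount-isolated : edgeCount G ≡ edgeCount H
  edgeCount-isolated = double-injective (begin
    edgeCount G + edgeCount G ≡⟨ handshake G ⟨
    ∑ (degree G)              ≡⟨ cong₂ _+_ degree-isolated-zero (sum-cong-≗ degree-isolated-suc) ⟩
    ∑ (degree H)              ≡⟨ handshake H ⟩
    edgeCount H + edgeCount H ∎)
    where open ≡-Reasoning

-- Walks and rankings

_++ʷ_ : ∀ {n} {G : Graph n} {u v w} → Walk G u v → Walk G v w → Walk G u w
here     ++ʷ q = q
step e p ++ʷ q = step e (p ++ʷ q)

reverseʷ : ∀ {n} {G : Graph n} {u v} → Walk G u v → Walk G v u
reverseʷ         here       = here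
reverseʷ {G = G} (step e p) = reverseʷ p ++ʷ step (Edge-sym G e) here

descent⇒connected : ∀ {n} {T : Graph n} (rank : Fin n → ℕ) (root : Fin n) (parent : Fin n → Fin n) →
  (∀ v → v ≡ root ⊎ Edge T v (parent v) × rank (parent v) < rank v) → Connected T
descent⇒connected {T = T} rank root parent descends u v = to-root u ++ʷ reverseʷ (to-root v)
  where
  climb : ∀ v → Acc _<_ (rank v) → Walk T v root
  climb v (acc smaller) with descends v
  ... | inj₁ refl       = here
  ... | inj₂ (e , down) = step e (climb (parent v) (smaller down))
  to-root : ∀ v → Walk T v root
  to-root v = climb v (<-wellFounded (rank v))

cycle-neighbours : ∀ {n} {G : Graph n} (C : Cycle G) i → let open Cycle C in
  Σ _ λ p → Σ _ λ q → p ≢ q × Edge G (vtx i) (vtx p) × Edge G (vtx i) (vtx q)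
cycle-neighbours {G = G} C zero    = 1F , fromℕ _ , (λ ()) , cons zero , Edge-sym G wrap
  where open Cycle C
cycle-neighbours {G = G} C (suc j) with view j
... | ‵fromℕ     = inject₁ j , zero , (λ ()) , Edge-sym G (cons j) , wrap
  where open Cycle C
... | ‵inject₁ t = inject₁ j , suc (suc t) , two-apart , Edge-sym G (cons j) , cons (suc t)
  where
  open Cycle C
  two-apart : inject₁ (inject₁ t) ≢ suc (suc t)
  two-apart e = m≢1+n+m (toℕ t)
    (≡.trans (≡.sym (≡.trans (toℕ-inject₁ (inject₁ t)) (toℕ-inject₁ t))) (cong toℕ e))

record Ranking {n} (T : Graph n) : Set where
  field
    rank         : Fin n → ℕ
    rank-≢       : ∀ u v → Edge T u v → rank u ≢ rank v
    lower-unique : ∀ v u w → Edge T v u → Edge T v w → rank u < rank v → rank w < rank v → u ≡ w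

ranking⇒acyclic : ∀ {n} {T : Graph n} → Ranking T → Acyclic T
ranking⇒acyclic {T = T} R C =
  let p , q , p≢q , top-p , top-q = cycle-neighbours C top
  in  p≢q (inj (lower-unique _ _ _ top-p top-q (below top-p) (below top-q)))
  where
  open Ranking R
  open Cycle C
  top : Fin (suc (suc (suc k)))
  top = argmax (rank ∘ vtx) zero (allFin _)
  below : ∀ {j} → Edge T (vtx top) (vtx j) → rank (vtx j) < rank (vtx top)
  below {j} e = ≤∧≢⇒< (All.lookup (f[xs]≤f[argmax] {f = rank ∘ vtx} zero (allFin _)) (∈-allFin j))
                      (rank-≢ _ _ e ∘ ≡.sym)

-- Subdividing an edge

subdivide-keeps-edge : ∀ {n} (T : Graph n) (a b : Fin n) {u v} → u ≢ a → u ≢ b →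
  Edge T u v → Edge (subdivide T a b) (suc u) (suc v)
subdivide-keeps-edge T a b {u} u≢a u≢b uv
  rewrite dec-false (u ≟ a) u≢a | dec-false (u ≟ b) u≢b | uv = refl

subdivide-keeps-non-edge : ∀ {n} (T : Graph n) (a b : Fin n) {u v} →
  adj T u v ≡ false → adj (subdivide T a b) (suc u) (suc v) ≡ false
subdivide-keeps-non-edge T a b uv = cong (_∧ _) uv

module _ {n} (T : Graph n) (a b : Fin n) (ab : Edge T a b) where

  private
    S : Graph (suc n)
    S = subdivide T a b

    a≢b : a ≢ b
    a≢b = Edge⇒≢ T ab

    kept-edge : ∀ {u v} → Edge S (suc u) (suc v) → Edge T u v × samePair a b u v ≡ false
    kept-edge {u} {v} e with adj T u v | samePair a b u v
    ... | true | false = refl , refl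

    endpoint-degree : ∀ {v w} → Edge T v w → oneOf a b v ≡ true → (∀ j → samePair a b v j ≡ does (j ≟ w)) →
      bit (oneOf a b v) + degree (removeEdge T a b) v ≡ degree T v
    endpoint-degree {v} {w} vw v∈ab row = begin
      bit (oneOf a b v) + degree (removeEdge T a b) v
        ≡⟨ cong₂ _+_ (cong bit v∈ab) (degree≡count (removeEdge T a b) v) ⟩
      suc (count (λ j → adj T v j ∧ not (samePair a b v j)))
        ≡⟨ cong suc (count-cong (λ j → cong (λ x → adj T v j ∧ not x) (row j))) ⟩
      suc (count (λ j → adj T v j ∧ not (does (j ≟ w)))) ≡⟨ count-remove (adj T v) vw ⟨
      count (adj T v)                                     ≡⟨ degree≡count T v ⟨
      degree T v                                          ∎
      where open ≡-Reasoning

  degree-removeEdge : ∀ v → bit (oneOf a b v) + degree (removeEdge T a b) v ≡ degree T v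
  degree-removeEdge v with endpoint-view a b v
  ... | inj₁ refl = endpoint-degree ab (oneOf-left a b) row
    where
    row : ∀ j → samePair a b a j ≡ does (j ≟ b)
    row j rewrite dec-true (a ≟ a) refl | dec-false (a ≟ b) a≢b = ∨-identityʳ _
  ... | inj₂ (inj₁ refl) = endpoint-degree (Edge-sym T ab) (oneOf-right a b) row
    where
    row : ∀ j → samePair a b b j ≡ does (j ≟ a)
    row j rewrite dec-false (b ≟ a) (a≢b ∘ ≡.sym) | dec-true (b ≟ b) refl = refl
  ... | inj₂ (inj₂ (v≢a , v≢b)) = begin
    bit (oneOf a b v) + degree (removeEdge T a b) v
      ≡⟨ cong₂ _+_ (cong bit (cong₂ _∨_ v≠a v≠b)) (degree≡count (removeEdge T a b) v) ⟩
    count (λ j → adj T v j ∧ not (samePair a b v j)) ≡⟨ count-cong kept ⟩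
    count (adj T v)                                  ≡⟨ degree≡count T v ⟨
    degree T v                                       ∎
    where
    open ≡-Reasoning
    v≠a = dec-false (v ≟ a) v≢a
    v≠b = dec-false (v ≟ b) v≢b
    kept : ∀ j → (adj T v j ∧ not (samePair a b v j)) ≡ adj T v j
    kept j rewrite v≠a | v≠b = ∧-identityʳ (adj T v j)

  degree-subdivide-zero : degree S zero ≡ 2
  degree-subdivide-zero = ≡.trans (degree-addVertex-zero (removeEdge T a b) (oneOf a b)) (count-oneOf a≢b)

  degree-subdivide-suc : ∀ v → degree S (suc v) ≡ degree T v
  degree-subdivide-suc v =
    ≡.trans (degree-addVertex-suc (removeEdge T a b) (oneOf a b) v) (degree-removeEdge v)

  lift-walk : ∀ {u v} → Walk T u v → Walk S (suc u) (suc v)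
  lift-walk here = here
  lift-walk (step {u} {w} e p) with samePair a b u w in same
  ... | false = step (cong₂ (λ x y → x ∧ not y) e same) (lift-walk p)
  ... | true with samePair-true a b u w same
  ...   | inj₁ (refl , refl) = step {w = zero} (oneOf-left a b) (step (oneOf-right a b) (lift-walk p))
  ...   | inj₂ (refl , refl) = step {w = zero} (oneOf-right a b) (step (oneOf-left a b) (lift-walk p))

  subdivide-connected : Connected T → Connected S
  subdivide-connected conn zero    zero    = here
  subdivide-connected conn zero    (suc v) = step {w = suc a} (oneOf-left a b) (lift-walk (conn a v))
  subdivide-connected conn (suc u) zero    = lift-walk (conn u a) ++ʷ step (oneOf-left a b) here
  subdivide-connected conn (suc u) (suc v) = lift-walk (conn u v)

  -- Doubling the old ranks makes room for the new vertex strictly between its two neighbours.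
  subdivide-ranking : Ranking T → Ranking S
  subdivide-ranking R = record { rank = rank′ ; rank-≢ = rank′-≢ ; lower-unique = lower-unique′ }
    where
    open Ranking R
    rank′ : Fin (suc n) → ℕ
    rank′ zero    = rank a + rank b
    rank′ (suc v) = rank v + rank v

    new-≢ : ∀ v → Edge S zero (suc v) → rank a + rank b ≢ rank v + rank v
    new-≢ v e with oneOf-true a b v e
    ... | inj₁ refl = rank-≢ b a (Edge-sym T ab) ∘ +-cancelˡ-≡ (rank a) (rank b) (rank a)
    ... | inj₂ refl = rank-≢ a b ab ∘ +-cancelʳ-≡ (rank b) (rank a) (rank b)

    rank′-≢ : ∀ u v → Edge S u v → rank′ u ≢ rank′ v
    rank′-≢ zero    (suc v) e = new-≢ v e
    rank′-≢ (suc u) zero    e = new-≢ u e ∘ ≡.sym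
    rank′-≢ (suc u) (suc v) e = rank-≢ u v (proj₁ (kept-edge e)) ∘ double-injective

    no-second-lower : ∀ v w → Edge S (suc v) zero → Edge S (suc v) (suc w) →
      rank′ zero < rank′ (suc v) → rank′ (suc w) < rank′ (suc v) → ⊥
    no-second-lower v w e₀ e new< w< with oneOf-true a b v e₀ | kept-edge e
    ... | inj₁ refl | aw , not-ab
      with lower-unique a w b aw ab (double-cancel-< w<) (+-cancelˡ-< (rank a) (rank b) (rank a) new<)
    ...   | refl = contradiction (≡.trans (≡.sym (samePair-ab a b)) not-ab) λ ()
    no-second-lower v w e₀ e new< w< | inj₂ refl | bw , not-ba
      with lower-unique b w a bw (Edge-sym T ab) (double-cancel-< w<)
                        (+-cancelʳ-< (rank b) (rank a) (rank b) new<)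
    ...   | refl = contradiction (≡.trans (≡.sym (samePair-ba a b)) not-ba) λ ()

    ra<rb : rank′ (suc a) < rank′ zero → rank a < rank b
    ra<rb = +-cancelˡ-< (rank a) (rank a) (rank b)
    rb<ra : rank′ (suc b) < rank′ zero → rank b < rank a
    rb<ra = +-cancelʳ-< (rank b) (rank b) (rank a)

    lower-unique′ : ∀ v u w → Edge S v u → Edge S v w → rank′ u < rank′ v → rank′ w < rank′ v → u ≡ w
    lower-unique′ zero    zero    _       ()
    lower-unique′ zero    (suc u) zero    _  ()
    lower-unique′ zero    (suc u) (suc w) eu ew u< w< with oneOf-true a b u eu | oneOf-true a b w ew
    ... | inj₁ refl | inj₁ refl = refl
    ... | inj₂ refl | inj₂ refl = refl
    ... | inj₁ refl | inj₂ refl = ⊥-elim (<-asym (ra<rb u<) (rb<ra w<))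
    ... | inj₂ refl | inj₁ refl = ⊥-elim (<-asym (ra<rb w<) (rb<ra u<))
    lower-unique′ (suc v) zero    zero    _  _  _  _  = refl
    lower-unique′ (suc v) zero    (suc w) eu ew u< w< = ⊥-elim (no-second-lower v w eu ew u< w<)
    lower-unique′ (suc v) (suc u) zero    eu ew u< w< = ⊥-elim (no-second-lower v u ew eu w< u<)
    lower-unique′ (suc v) (suc u) (suc w) eu ew u< w< =
      cong suc (lower-unique v u w (proj₁ (kept-edge eu)) (proj₁ (kept-edge ew))
                                   (double-cancel-< u<) (double-cancel-< w<))

Exclusive : ∀ {n} → Graph n → Graph n → Fin n → Fin n → Set
Exclusive G H u v = Edge G u v × adj H u v ≡ false

record DoubleSubdivision {n} (T₁ T₂ : Graph n) (a b c d : Fin n) : Set where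
  field
    ab-exclusive : Exclusive T₁ T₂ a b
    cd-exclusive : Exclusive T₂ T₁ c d
    a≢c : a ≢ c
    a≢d : a ≢ d
    b≢c : b ≢ c
    b≢d : b ≢ d

module _ {n} {T₁ T₂ : Graph n} {a b c d : Fin n} (P : DoubleSubdivision T₁ T₂ a b c d) where

  open DoubleSubdivision P

  private
    S₁ S₂ : Graph (suc n)
    S₁ = subdivide T₁ a b
    S₂ = subdivide T₂ c d

  common-subdivide-zero : ∀ v → adj (commonGraph S₁ S₂) zero v ≡ false
  common-subdivide-zero zero    = refl
  common-subdivide-zero (suc v) with endpoint-view a b v
  ... | inj₁ refl        rewrite dec-false (a ≟ c) a≢c | dec-false (a ≟ d) a≢d = ∧-zeroʳ _
  ... | inj₂ (inj₁ refl) rewrite dec-false (b ≟ c) b≢c | dec-false (b ≟ d) b≢d = ∧-zeroʳ _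
  ... | inj₂ (inj₂ (v≢a , v≢b)) rewrite dec-false (v ≟ a) v≢a | dec-false (v ≟ b) v≢b = refl

  -- Each removed pair lies outside the other tree, so the intersection does not change.
  common-subdivide-suc : ∀ u v → adj (commonGraph S₁ S₂) (suc u) (suc v) ≡ adj (commonGraph T₁ T₂) u v
  common-subdivide-suc u v =
    drop-removals (adj T₁ u v) (adj T₂ u v) (samePair a b u v) (samePair c d u v)
                  (samePair-adj T₂ (proj₂ ab-exclusive) u v) (samePair-adj T₁ (proj₂ cd-exclusive) u v)
    where
    drop-removals : ∀ x₁ x₂ p q → (p ≡ true → x₂ ≡ false) → (q ≡ true → x₁ ≡ false) →
      ((x₁ ∧ not p) ∧ (x₂ ∧ not q)) ≡ (x₁ ∧ x₂)
    drop-removals x₁ x₂ true  q     p⇒ _  rewrite p⇒ refl | ∧-zeroʳ x₁ = refl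
    drop-removals x₁ x₂ false true  _  q⇒ rewrite q⇒ refl = refl
    drop-removals x₁ x₂ false false _  _  = cong₂ _∧_ (∧-identityʳ x₁) (∧-identityʳ x₂)

  private
    common-degree-zero : degree (commonGraph S₁ S₂) zero ≡ 0
    common-degree-zero =
      degree-isolated-zero (commonGraph S₁ S₂) (commonGraph T₁ T₂) common-subdivide-zero common-subdivide-suc

    common-degree-suc : ∀ v → degree (commonGraph S₁ S₂) (suc v) ≡ degree (commonGraph T₁ T₂) v
    common-degree-suc =
      degree-isolated-suc (commonGraph S₁ S₂) (commonGraph T₁ T₂) common-subdivide-zero common-subdivide-suc

  degree-∪-subdivide-zero : degree (S₁ ∪G S₂) zero ≡ 4
  degree-∪-subdivide-zero = begin
    degree (S₁ ∪G S₂) zero                                   ≡⟨ +-identityʳ _ ⟨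
    degree (S₁ ∪G S₂) zero + 0                               ≡⟨ cong (degree (S₁ ∪G S₂) zero +_) common-degree-zero ⟨
    degree (S₁ ∪G S₂) zero + degree (commonGraph S₁ S₂) zero ≡⟨ degree-∪ S₁ S₂ zero ⟩
    degree S₁ zero + degree S₂ zero
      ≡⟨ cong₂ _+_ (degree-subdivide-zero T₁ a b (proj₁ ab-exclusive))
                   (degree-subdivide-zero T₂ c d (proj₁ cd-exclusive)) ⟩
    4                                                        ∎
    where open ≡-Reasoning

  degree-∪-subdivide-suc : ∀ v → degree (S₁ ∪G S₂) (suc v) ≡ degree (T₁ ∪G T₂) v
  degree-∪-subdivide-suc v = +-cancelʳ-≡ (degree (commonGraph T₁ T₂) v) _ _ (begin
    degree (S₁ ∪G S₂) (suc v) + degree (commonGraph T₁ T₂) v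
      ≡⟨ cong (degree (S₁ ∪G S₂) (suc v) +_) (common-degree-suc v) ⟨
    degree (S₁ ∪G S₂) (suc v) + degree (commonGraph S₁ S₂) (suc v) ≡⟨ degree-∪ S₁ S₂ (suc v) ⟩
    degree S₁ (suc v) + degree S₂ (suc v)
      ≡⟨ cong₂ _+_ (degree-subdivide-suc T₁ a b (proj₁ ab-exclusive) v)
                   (degree-subdivide-suc T₂ c d (proj₁ cd-exclusive) v) ⟩
    degree T₁ v + degree T₂ v                                       ≡⟨ degree-∪ T₁ T₂ v ⟨
    degree (T₁ ∪G T₂) v + degree (commonGraph T₁ T₂) v              ∎)
    where open ≡-Reasoning

-- Towers of subdivisions

shift : ∀ L → Fin 8 → Fin (8 + L)
shift zero    x = x
shift (suc L) x = suc (shift L x)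

shift-injective : ∀ L {x y} → shift L x ≡ shift L y → x ≡ y
shift-injective zero    e = e
shift-injective (suc L) e = shift-injective L (Fin-suc-injective e)

toℕ-shift : ∀ L x → toℕ (shift L x) ≡ L + toℕ x
toℕ-shift zero    x = refl
toℕ-shift (suc L) x = cong suc (toℕ-shift L x)

shift-≢ : ∀ L {x} {y : Fin (8 + L)} → toℕ y < toℕ x → shift L x ≢ y
shift-≢ L {x} y<x refl = <⇒≱ y<x (≤-trans (m≤n+m (toℕ x) L) (≤-reflexive (≡.sym (toℕ-shift L x))))

tower : Graph 8 → (a b : ∀ L → Fin (8 + L)) → ∀ L → Graph (8 + L)
tower G a b zero    = G
tower G a b (suc L) = subdivide (tower G a b L) (a L) (b L)

module _ (G : Graph 8) (a b : ∀ L → Fin (8 + L)) where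

  tower-non-edge : ∀ {x y} → adj G x y ≡ false → ∀ L → adj (tower G a b L) (shift L x) (shift L y) ≡ false
  tower-non-edge xy zero    = xy
  tower-non-edge xy (suc L) = subdivide-keeps-non-edge (tower G a b L) (a L) (b L) (tower-non-edge xy L)

  tower-edge : ∀ {x y} → (∀ L → toℕ (a L) < toℕ x) → (∀ L → toℕ (b L) < toℕ x) →
    Edge G x y → ∀ L → Edge (tower G a b L) (shift L x) (shift L y)
  tower-edge a<x b<x xy zero    = xy
  tower-edge a<x b<x xy (suc L) =
    subdivide-keeps-edge (tower G a b L) (a L) (b L) (shift-≢ L (a<x L)) (shift-≢ L (b<x L))
                         (tower-edge a<x b<x xy L)

  module _ (ab : ∀ L → Edge (tower G a b L) (a L) (b L)) where

    tower-connected : Connected G → ∀ L → Connected (tower G a b L)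
    tower-connected conn zero    = conn
    tower-connected conn (suc L) =
      subdivide-connected (tower G a b L) (a L) (b L) (ab L) (tower-connected conn L)

    tower-ranking : Ranking G → ∀ L → Ranking (tower G a b L)
    tower-ranking R zero    = R
    tower-ranking R (suc L) =
      subdivide-ranking (tower G a b L) (a L) (b L) (ab L) (tower-ranking R L)

does-≟-sym : ∀ {n} (u v : Fin n) → does (u ≟ v) ≡ does (v ≟ u)
does-≟-sym u v with u ≟ v
... | yes refl = ≡.sym (dec-true (u ≟ u) refl)
... | no u≢v   = ≡.sym (dec-false (v ≟ u) (u≢v ∘ ≡.sym))

listed : ∀ {n} → List (Fin n × Fin n) → Fin n → Fin n → Bool
listed es u v = any (λ (x , y) → does (x ≟ u) ∧ does (y ≟ v)) es

fromEdges : ∀ {n} → List (Fin n × Fin n) → Graph n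
fromEdges es = record
  { adj    = λ u v → (listed es u v ∨ listed es v u) ∧ not (does (u ≟ v))
  ; sym    = λ u v → cong₂ (λ x y → x ∧ not y) (∨-comm (listed es u v) _) (does-≟-sym u v)
  ; irrefl = λ v → ≡.trans (cong (λ y → (listed es v v ∨ listed es v v) ∧ not y) (dec-true (v ≟ v) refl))
                           (∧-zeroʳ _)
  }

Edge? : ∀ {n} (G : Graph n) u v → Dec (Edge G u v)
Edge? G u v = adj G u v ≟ᵇ true

C4Edge? : ∀ {n} (a b c e u v : Fin n) → Dec (C4Edge a b c e u v)
C4Edge? a b c e u v = pair? a b ⊎-dec pair? b c ⊎-dec pair? c e ⊎-dec pair? e a
  where
  pair? : ∀ x y → Dec ((u ≡ x × v ≡ y) ⊎ (u ≡ y × v ≡ x))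
  pair? x y = (u ≟ x ×-dec v ≟ y) ⊎-dec (u ≟ y ×-dec v ≟ x)

module _ {n} (T : Graph n) (rank : Fin n → ℕ) where

  rank-≢? : Dec (∀ u v → Edge T u v → rank u ≢ rank v)
  rank-≢? = all? λ u → all? λ v → Edge? T u v →-dec ¬? (rank u ≟ℕ rank v)

  lower-unique? : Dec (∀ v u w → Edge T v u → Edge T v w → rank u < rank v → rank w < rank v → u ≡ w)
  lower-unique? = all? λ v → all? λ u → all? λ w →
    Edge? T v u →-dec Edge? T v w →-dec rank u <? rank v →-dec rank w <? rank v →-dec u ≟ w

  descends? : (root : Fin n) (parent : Fin n → Fin n) →
    Dec (∀ v → v ≡ root ⊎ Edge T v (parent v) × rank (parent v) < rank v)
  descends? root parent = all? λ v → v ≟ root ⊎-dec Edge? T v (parent v) ×-dec rank (parent v) <? rank v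

base₁ base₂ : Graph 8
base₁ = fromEdges ((0F , 1F) ∷ (0F , 2F) ∷ (1F , 3F) ∷ (2F , 6F) ∷ (4F , 5F) ∷ (4F , 6F) ∷ (5F , 7F) ∷ [])
base₂ = fromEdges ((0F , 3F) ∷ (1F , 4F) ∷ (2F , 5F) ∷ (3F , 7F) ∷ (4F , 5F) ∷ (4F , 6F) ∷ (6F , 7F) ∷ [])

depth₁ depth₂ : Fin 8 → ℕ
depth₁ = lookup (0 ∷ 1 ∷ 1 ∷ 2 ∷ 3 ∷ 4 ∷ 2 ∷ 5 ∷ [])
depth₂ = lookup (0 ∷ 5 ∷ 6 ∷ 1 ∷ 4 ∷ 5 ∷ 3 ∷ 2 ∷ [])

parent₁ parent₂ : Fin 8 → Fin 8
parent₁ = lookup (0F ∷ 0F ∷ 0F ∷ 1F ∷ 6F ∷ 4F ∷ 2F ∷ 5F ∷ [])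
parent₂ = lookup (0F ∷ 4F ∷ 5F ∷ 0F ∷ 6F ∷ 4F ∷ 7F ∷ 3F ∷ [])

base₁-ranking : Ranking base₁
base₁-ranking = record
  { rank         = depth₁
  ; rank-≢       = from-yes (rank-≢? base₁ depth₁)
  ; lower-unique = from-yes (lower-unique? base₁ depth₁)
  }

base₂-ranking : Ranking base₂
base₂-ranking = record
  { rank         = depth₂
  ; rank-≢       = from-yes (rank-≢? base₂ depth₂)
  ; lower-unique = from-yes (lower-unique? base₂ depth₂)
  }

base₁-connected : Connected base₁
base₁-connected = descent⇒connected depth₁ 0F parent₁ (from-yes (descends? base₁ depth₁ 0F parent₁))

base₂-connected : Connected base₂
base₂-connected = descent⇒connected depth₂ 0F parent₂ (from-yes (descends? base₂ depth₂ 0F parent₂))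

tree₁ tree₂ graph common : ∀ L → Graph (8 + L)
tree₁ = tower base₁ (λ _ → 0F) (λ _ → 1F)
tree₂ = tower base₂ (λ _ → 2F) (λ _ → 5F)
graph  L = tree₁ L ∪G tree₂ L
common L = commonGraph (tree₁ L) (tree₂ L)

edge₀₁ : ∀ L → Exclusive (tree₁ L) (tree₂ L) 0F 1F
edge₀₁ zero    = refl , refl
edge₀₁ (suc L) = refl , refl

-- The tree₂-edge from the newest vertex to its first tree₂-neighbour moves from 0–3 to 1–4 to 2–5,
-- where it is subdivided.
edge₀₃ : ∀ L → Exclusive (tree₂ L) (tree₁ L) 0F 3F
edge₀₃ zero    = refl , refl
edge₀₃ (suc L) = refl , refl

tree₂-keeps-exclusive : ∀ L {u v} → u ≢ 2F → u ≢ 5F →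
  Exclusive (tree₂ L) (tree₁ L) u v → Exclusive (tree₂ (suc L)) (tree₁ (suc L)) (suc u) (suc v)
tree₂-keeps-exclusive L u≢2 u≢5 (uv , uv∉tree₁) =
  subdivide-keeps-edge (tree₂ L) 2F 5F u≢2 u≢5 uv , subdivide-keeps-non-edge (tree₁ L) 0F 1F uv∉tree₁

edge₁₄ : ∀ L → Exclusive (tree₂ L) (tree₁ L) 1F 4F
edge₁₄ zero    = refl , refl
edge₁₄ (suc L) = tree₂-keeps-exclusive L (λ ()) (λ ()) (edge₀₃ L)

edge₂₅ : ∀ L → Exclusive (tree₂ L) (tree₁ L) 2F 5F
edge₂₅ zero    = refl , refl
edge₂₅ (suc L) = tree₂-keeps-exclusive L (λ ()) (λ ()) (edge₁₄ L)

level-subdivision : ∀ L → DoubleSubdivision (tree₁ L) (tree₂ L) 0F 1F 2F 5F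
level-subdivision L = record
  { ab-exclusive = edge₀₁ L ; cd-exclusive = edge₂₅ L ; a≢c = λ () ; a≢d = λ () ; b≢c = λ () ; b≢d = λ () }

stairs : ∀ {n} → ℕ → ℕ → Fin n → ℕ
stairs k c i = if toℕ i <ᵇ c then suc k else k

degree-graph : ∀ L i → degree (graph L) i ≡ stairs 3 L i
degree-graph zero    i       = from-yes (all? λ i → degree (graph 0) i ≟ℕ 3) i
degree-graph (suc L) zero    = degree-∪-subdivide-zero (level-subdivision L)
degree-graph (suc L) (suc i) = ≡.trans (degree-∪-subdivide-suc (level-subdivision L) i) (degree-graph L i)

∑-stairs : ∀ L → ∑ (stairs {8 + L} 3 L) ≡ 24 + 4 * L
∑-stairs zero    = refl
∑-stairs (suc L) = ≡.trans (cong (4 +_) (∑-stairs L)) (rearrange L)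
  where
  rearrange : ∀ L → 4 + (24 + 4 * L) ≡ 24 + 4 * suc L
  rearrange = solve-∀

edgeCount-graph : ∀ L → edgeCount (graph L) + 4 ≡ 2 * (8 + L)
edgeCount-graph L = ≡.trans (cong (_+ 4) (double-injective {n = 12 + 2 * L} twice)) (halve L)
  where
  open ≡-Reasoning
  halve : ∀ L → (12 + 2 * L) + 4 ≡ 2 * (8 + L)
  halve = solve-∀
  double : ∀ L → 24 + 4 * L ≡ (12 + 2 * L) + (12 + 2 * L)
  double = solve-∀
  twice : edgeCount (graph L) + edgeCount (graph L) ≡ (12 + 2 * L) + (12 + 2 * L)
  twice = begin
    edgeCount (graph L) + edgeCount (graph L) ≡⟨ handshake (graph L) ⟨
    ∑ (degree (graph L))                      ≡⟨ sum-cong-≗ (degree-graph L) ⟩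
    ∑ (stairs {8 + L} 3 L)                    ≡⟨ ∑-stairs L ⟩
    24 + 4 * L                                ≡⟨ double L ⟩
    (12 + 2 * L) + (12 + 2 * L)               ∎

common-edgeCount : ∀ L → edgeCount (common L) ≡ 2
common-edgeCount zero    = refl
common-edgeCount (suc L) = ≡.trans
  (edgeCount-isolated (common (suc L)) (common L)
    (common-subdivide-zero (level-subdivision L)) (common-subdivide-suc (level-subdivision L)))
  (common-edgeCount L)

common-shift : ∀ L x y → adj (common L) (shift L x) (shift L y) ≡ adj (common 0) x y
common-shift zero    x y = refl
common-shift (suc L) x y =
  ≡.trans (common-subdivide-suc (level-subdivision L) (shift L x) (shift L y)) (common-shift L x y)

common-C4 : ∀ L u v → Edge (common L) u v → C4Edge (shift L 5F) (shift L 4F) (shift L 6F) (shift L 7F) u v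
common-C4 zero    = from-yes (all? λ u → all? λ v → Edge? (common 0) u v →-dec C4Edge? 5F 4F 6F 7F u v)
common-C4 (suc L) zero    v       e =
  contradiction (≡.trans (≡.sym e) (common-subdivide-zero (level-subdivision L) v)) λ ()
common-C4 (suc L) (suc u) zero    e = contradiction
  (≡.trans (≡.sym e) (≡.trans (sym (common (suc L)) (suc u) zero)
                              (common-subdivide-zero (level-subdivision L) (suc u))))
  λ ()
common-C4 (suc L) (suc u) (suc v) e =
  C4Edge-map suc (common-C4 L u v (≡.trans (≡.sym (common-subdivide-suc (level-subdivision L) u v)) e))

graph-pivotable : ∀ L → C4Pivotable (graph L)
graph-pivotable L =
  edgeCount-graph L , A , B , C , E , induced , tree₁ L , tree₂ L ,
  ((λ _ _ → ∪-left (tree₁ L) (tree₂ L)) , connected₁ , ranking⇒acyclic ranking₁) ,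
  ((λ _ _ → ∪-right (tree₁ L) (tree₂ L)) , connected₂ , ranking⇒acyclic ranking₂) ,
  common-edgeCount L , common-C4 L
  where
  A B C E : Fin (8 + L)
  A = shift L 5F
  B = shift L 4F
  C = shift L 6F
  E = shift L 7F
  connected₁ : Connected (tree₁ L)
  connected₁ = tower-connected base₁ _ _ (proj₁ ∘ edge₀₁) base₁-connected L
  connected₂ : Connected (tree₂ L)
  connected₂ = tower-connected base₂ _ _ (proj₁ ∘ edge₂₅) base₂-connected L
  ranking₁ : Ranking (tree₁ L)
  ranking₁ = tower-ranking base₁ _ _ (proj₁ ∘ edge₀₁) base₁-ranking L
  ranking₂ : Ranking (tree₂ L)
  ranking₂ = tower-ranking base₂ _ _ (proj₁ ∘ edge₂₅) base₂-ranking L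
  apart : ∀ {x y} → x ≢ y → shift L x ≢ shift L y
  apart x≢y = x≢y ∘ shift-injective L
  common-edge : ∀ {x y} → Edge (common 0) x y → Edge (graph L) (shift L x) (shift L y)
  common-edge {x} {y} e = common⇒∪ (tree₁ L) (tree₂ L) (≡.trans (common-shift L x y) e)
  non-edge : ∀ {x y} → adj (graph 0) x y ≡ false → adj (graph L) (shift L x) (shift L y) ≡ false
  non-edge {x} {y} xy with adj base₁ x y in xy₁ | adj base₂ x y in xy₂
  ... | false | false = cong₂ _∨_ (tower-non-edge base₁ _ _ xy₁ L) (tower-non-edge base₂ _ _ xy₂ L)
  induced : InducedC4 (graph L) A B C E
  induced =
    apart (λ ()) , apart (λ ()) , apart (λ ()) , apart (λ ()) , apart (λ ()) , apart (λ ()) ,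
    common-edge refl , common-edge refl ,
    ∪-right (tree₁ L) (tree₂ L) (tower-edge base₂ _ _ (λ _ → from-yes (2 <? 6)) (λ _ → from-yes (5 <? 6)) refl L) ,
    ∪-left (tree₁ L) (tree₂ L) (tower-edge base₁ _ _ (λ _ → from-yes (0 <? 7)) (λ _ → from-yes (1 <? 7)) refl L) ,
    non-edge refl , non-edge refl

-- Degree sequences

∑-lower-bound : ∀ {n k} (f : Fin n → ℕ) → (∀ i → k ≤ f i) → n * k ≤ ∑ f
∑-lower-bound {zero}  f k≤f = z≤n
∑-lower-bound {suc n} f k≤f = +-mono-≤ (k≤f zero) (∑-lower-bound (f ∘ suc) (k≤f ∘ suc))

∑-upper-bound : ∀ {n k} (f : Fin n → ℕ) → (∀ i → f i ≤ k) → ∑ f ≤ n * k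
∑-upper-bound {zero}  f f≤k = z≤n
∑-upper-bound {suc n} f f≤k = +-mono-≤ (f≤k zero) (∑-upper-bound (f ∘ suc) (f≤k ∘ suc))

last-≤ : ∀ {m} (d : Fin (suc m) → ℕ) → NonIncreasing d → ∀ i → d (fromℕ m) ≤ d i
last-≤ {m} d non-increasing i =
  non-increasing i (fromℕ m) (≤-trans (toℕ≤pred[n] i) (≤-reflexive (≡.sym (toℕ-fromℕ m))))

≤-first : ∀ {m} (d : Fin (suc m) → ℕ) → NonIncreasing d → ∀ i → d i ≤ d zero
≤-first d non-increasing i = non-increasing zero i z≤n

two-valued⇒stairs : ∀ {n k} (d : Fin n → ℕ) → NonIncreasing d → (∀ i → k ≤ d i) → (∀ i → d i ≤ suc k) →
  ∀ c → ∑ d ≡ c + n * k → ∀ i → d i ≡ stairs k c i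
two-valued⇒stairs {suc n} {k} d non-increasing lower upper c sum≡ i with m≤n⇒m<n∨m≡n (upper zero)
... | inj₁ d₀<1+k = ≡.trans (all-k i) (cong (λ c → stairs k c i) (≡.sym c≡0))
  where
  all-k : ∀ i → d i ≡ k
  all-k i = ≤-antisym (≤-trans (≤-first d non-increasing i) (≤-pred d₀<1+k)) (lower i)
  c≡0 : c ≡ 0
  c≡0 = n≤0⇒n≡0 (+-cancelʳ-≤ (suc n * k) c 0
          (≤-trans (≤-reflexive (≡.sym sum≡)) (∑-upper-bound d (≤-reflexive ∘ all-k))))
... | inj₂ d₀≡1+k = top c sum≡ i
  where
  head-sum : ∀ {s} → ∑ d ≡ s → suc k + ∑ (d ∘ suc) ≡ s
  head-sum = ≡.trans (cong (_+ ∑ (d ∘ suc)) (≡.sym d₀≡1+k))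
  rearrange : ∀ c k m → c + (k + m) ≡ k + (c + m)
  rearrange = solve-∀
  top : ∀ c → ∑ d ≡ c + suc n * k → ∀ i → d i ≡ stairs k c i
  top zero    sum≡ i       =
    contradiction (head-sum sum≡) (<⇒≢ (s≤s (+-monoʳ-≤ k (∑-lower-bound (d ∘ suc) (lower ∘ suc)))) ∘ ≡.sym)
  top (suc c) sum≡ zero    = d₀≡1+k
  top (suc c) sum≡ (suc i) =
    two-valued⇒stairs (d ∘ suc) (λ i j → non-increasing (suc i) (suc j) ∘ s≤s) (lower ∘ suc) (upper ∘ suc) c
      (+-cancelˡ-≡ k _ _ (≡.trans (suc-injective (head-sum sum≡)) (rearrange c k (n * k)))) i

stairs-realization : ∀ L {m} → 7 + L ≡ m → (d : Fin (suc m) → ℕ) → NonIncreasing d →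
  (∀ i → 3 ≤ d i) → (∀ i → d i ≤ 4) → ∑ d + 4 ≡ 4 * m → Σ (Graph (suc m)) λ G → Realizes G d × C4Pivotable G
stairs-realization L refl d non-increasing lower upper sum≡ = graph L , realizes , graph-pivotable L
  where
  rearrange : ∀ L → 4 * (7 + L) ≡ (L + (8 + L) * 3) + 4
  rearrange = solve-∀
  realizes : Realizes (graph L) d
  realizes i = ≡.trans (degree-graph L i)
    (≡.sym (two-valued⇒stairs d non-increasing lower upper L
                              (+-cancelʳ-≡ 4 _ _ (≡.trans sum≡ (rearrange L))) i))

lemma4p4 : (m : ℕ) (d : Fin (suc m) → ℕ) →
    Graphical d →
    seqSum d + 4 ≡ 4 * m →
    d zero ≤ 4 →
    d (fromℕ m) ≡ 3 →
    Σ (Graph (suc m)) λ G → Realizes G d × C4Pivotable G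
lemma4p4 m d (non-increasing , _) seqSum≡ d₀≤4 dₘ≡3 =
  let L , 7+L≡m = m≤n⇒∃[o]m+o≡n seven≤m
  in  stairs-realization L 7+L≡m d non-increasing lower upper sum≡
  where
  sum≡ : ∑ d + 4 ≡ 4 * m
  sum≡ = ≡.trans (cong (_+ 4) (≡.sym (sum-map-allFin d))) seqSum≡
  lower : ∀ i → 3 ≤ d i
  lower i = ≤-trans (≤-reflexive (≡.sym dₘ≡3)) (last-≤ d non-increasing i)
  upper : ∀ i → d i ≤ 4
  upper i = ≤-trans (≤-first d non-increasing i) d₀≤4
  rearrange₁ : ∀ m → 7 + m * 3 ≡ suc m * 3 + 4
  rearrange₁ = solve-∀
  rearrange₂ : ∀ m → 4 * m ≡ m + m * 3
  rearrange₂ = solve-∀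
  seven≤m : 7 ≤ m
  seven≤m = +-cancelʳ-≤ (m * 3) 7 m (begin
    7 + m * 3     ≡⟨ rearrange₁ m ⟩
    suc m * 3 + 4 ≤⟨ +-monoˡ-≤ 4 (∑-lower-bound d lower) ⟩
    ∑ d + 4       ≡⟨ sum≡ ⟩
    4 * m         ≡⟨ rearrange₂ m ⟩
    m + m * 3     ∎)
    where open ≤-Reasoning
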